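{- Let $n\in\{2,3,4,5\}$. The polynomials in $\lambda,\mu$ $$\mathbf D(\lambda,\mu)=D\!\left(\lambda a-\mu\tfrac{\partial D}{\partial b},\ \lambda b+\mu\tfrac{\partial D}{\partial a}\right)\Big/D(a,b),\quad \mathbf c_4(\lambda,\mu)=c_4\!\left(\lambda a-\mu\tfrac{\partial D}{\partial b},\ \lambda b+\mu\tfrac{\partial D}{\partial a}\right),$$ $$\mathbf c_6(\lambda,\mu)=c_6\!\left(\lambda a-\mu\tfrac{\partial D}{\partial b},\ \lambda b+\mu\tfrac{\partial D}{\partial a}\right)$$ all have coefficients in the subring $K[c_4,c_6]$ of $K[a,b]$ generated by $c_4=c_4(a,b)$ and $c_6=c_6(a,b)$.
   Context: $K$ is a field with $\operatorname{char}K\nmid 6n$. $D\in K[a,b]$ is $a(64a^2-b^2)$, $-a(27a^3+b^3)$, $ab(16a^4-b^4)$, $ab(a^{10}-11a^5b^5-b^{10})$ for $n=2,3,4,5$; $c_4=\frac{ -1}{((\deg D)-1)^2}\left(\frac{\partial^2D}{\partial a^2}\frac{\partial^2D}{\partial b^2}-\left(\frac{\partial^2D}{\partial a\partial b}\right)^2\right)$ and $c_6=\frac1{\deg c_4}\left(\frac{\partial D}{\partial a}\frac{\partial c_4}{\partial b}-\frac{\partial D}{\partial b}\frac{\partial c_4}{\partial a}\right)$. (A priori $\mathbf D$ has coefficients in the fraction field of $K[a,b]$.) -}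

module Defs where

open import Level using (_⊔_)
open import Algebra.Bundles using (CommutativeRing)
open import Data.Nat as ℕ using (ℕ; zero; suc)
open import Data.Integer as ℤ using (ℤ; +_; -[1+_])
open import Data.Fin using (Fin; zero; suc)
open import Data.List using (List; []; _∷_; map; foldr)
open import Data.Bool using (Bool; true; false; _∧_)
open import Data.Product using (∃)
open import Relation.Nullary using (¬_)
open import Relation.Binary.PropositionalEquality using (_≡_; refl)

record IsField {c ℓ} (K : CommutativeRing c ℓ) : Set (c ⊔ ℓ) where
  open CommutativeRing K using (Carrier; _≈_; _+_; _*_; -_; 0#; 1#)
  field
    0≉1     : ¬ (0# ≈ 1#)
    inverse : ∀ x → ¬ (x ≈ 0#) → ∃ λ y → x * y ≈ 1#

data Index : Set where
  two three four five : Index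

val : Index → ℕ
val two   = 2
val three = 3
val four  = 4
val five  = 5

-- Dense bivariate integer polynomials in a, b:
-- a list of rows, row i = coefficients of a^i b^0, a^i b^1, ...
-- (D, c4, c6 all have integer coefficients; all computations of D, its
-- derivatives, c4, c6 are done over ℤ and then mapped into K.)

Row : Set
Row = List ℤ

ZPoly : Set
ZPoly = List Row

addRow : Row → Row → Row
addRow []       ys       = ys
addRow xs       []       = xs
addRow (x ∷ xs) (y ∷ ys) = (x ℤ.+ y) ∷ addRow xs ys

scaleRow : ℤ → Row → Row
scaleRow k = map (k ℤ.*_)

mulRow : Row → Row → Row
mulRow []       ys = []
mulRow (x ∷ xs) ys = addRow (scaleRow x ys) (+ 0 ∷ mulRow xs ys)

addZ : ZPoly → ZPoly → ZPoly
addZ []       q        = q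
addZ p        []       = p
addZ (r ∷ rs) (s ∷ ss) = addRow r s ∷ addZ rs ss

negZ : ZPoly → ZPoly
negZ = map (map (λ z → ℤ.- z))

subZ : ZPoly → ZPoly → ZPoly
subZ p q = addZ p (negZ q)

mulRowZ : Row → ZPoly → ZPoly
mulRowZ r = map (mulRow r)

mulZ : ZPoly → ZPoly → ZPoly
mulZ []       q = []
mulZ (r ∷ rs) q = addZ (mulRowZ r q) ([] ∷ mulZ rs q)

derRow : Row → Row
derRow = go 1
  where
  go : ℕ → Row → Row
  go k []       = []
  go k (x ∷ xs) = (+ k ℤ.* x) ∷ go (suc k) xs

∂a : ZPoly → ZPoly
∂a []       = []
∂a (_ ∷ rs) = go 1 rs
  where
  go : ℕ → ZPoly → ZPoly
  go k []       = []
  go k (r ∷ rs) = scaleRow (+ k) r ∷ go (suc k) rs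

∂b : ZPoly → ZPoly
∂b = map (λ r → derRow (dropHead r))
  where
  dropHead : Row → Row
  dropHead []       = []
  dropHead (_ ∷ xs) = xs

isZeroℤ : ℤ → Bool
isZeroℤ (+ zero) = true
isZeroℤ _        = false

degRow : ℕ → Row → ℕ
degRow k []       = 0
degRow k (x ∷ xs) with isZeroℤ x
... | true  = degRow (suc k) xs
... | false = k ℕ.⊔ degRow (suc k) xs

degZ : ZPoly → ℕ
degZ = go 0
  where
  go : ℕ → ZPoly → ℕ
  go i []       = 0
  go i (r ∷ rs) = degRow i r ℕ.⊔ go (suc i) rs

isZeroZ : ZPoly → Bool
isZeroZ = foldr (λ r b → foldr (λ x b' → isZeroℤ x ∧ b') true r ∧ b) true

-- exact division of all coefficients by a positive integer
-- (only applied where the division is exact, see the facts below)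
divℕ : ℤ → ℕ → ℤ
divℕ z zero    = z
divℕ z (suc k) = z ℤ./ℕ suc k

divZ : ZPoly → ℕ → ZPoly
divZ p k = map (map (λ z → divℕ z k)) p

scaleZ : ℤ → ZPoly → ZPoly
scaleZ k = map (scaleRow k)

mono : ℤ → ℕ → ℕ → ZPoly
mono c i j = pad i (row j)
  where
  row : ℕ → Row
  row zero    = c ∷ []
  row (suc j) = + 0 ∷ row j
  pad : ℕ → Row → ZPoly
  pad zero    r = r ∷ []
  pad (suc i) r = [] ∷ pad i r

DZ : Index → ZPoly
DZ two   = addZ (mono (+ 64) 3 0) (mono (ℤ.- + 1) 1 2)
DZ three = addZ (mono (ℤ.- + 27) 4 0) (mono (ℤ.- + 1) 1 3)
DZ four  = addZ (mono (+ 16) 5 1) (mono (ℤ.- + 1) 1 5)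
DZ five  = addZ (mono (+ 1) 11 1) (addZ (mono (ℤ.- + 11) 6 6) (mono (ℤ.- + 1) 1 11))

degD : Index → ℕ
degD n = degZ (DZ n)

hessZ : ZPoly → ZPoly
hessZ D = subZ (mulZ (∂a (∂a D)) (∂b (∂b D))) (mulZ (∂a (∂b D)) (∂a (∂b D)))

c4Z : Index → ZPoly
c4Z n = divZ (negZ (hessZ (DZ n))) ((degD n ℕ.∸ 1) ℕ.* (degD n ℕ.∸ 1))

jacZ : ZPoly → ZPoly → ZPoly
jacZ D c = subZ (mulZ (∂a D) (∂b c)) (mulZ (∂b D) (∂a c))

c6Z : Index → ZPoly
c6Z n = divZ (jacZ (DZ n) (c4Z n)) (degZ (c4Z n))

-- Sanity facts: the divisions above are exact over ℤ, i.e.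
--   ((deg D)-1)^2 · c4 = -(D_aa D_bb - D_ab^2)   and
--   (deg c4) · c6 = D_a c4_b - D_b c4_a,
-- so c4, c6 are exactly the polynomials of the paper (with integer
-- coefficients, then mapped into K).
exact4 : ∀ n → isZeroZ (addZ (scaleZ (+ ((degD n ℕ.∸ 1) ℕ.* (degD n ℕ.∸ 1))) (c4Z n)) (hessZ (DZ n))) ≡ true
exact4 two   = refl
exact4 three = refl
exact4 four  = refl
exact4 five  = refl

exact6 : ∀ n → isZeroZ (subZ (scaleZ (+ degZ (c4Z n)) (c6Z n)) (jacZ (DZ n) (c4Z n))) ≡ true
exact6 two   = refl
exact6 three = refl
exact6 four  = refl
exact6 five  = refl

-- Polynomial rings K[x_0, ..., x_{m-1}] over a commutative ring K,
-- realised as the free commutative K-algebra on m generators: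
-- expressions modulo the congruence generated by the commutative-ring
-- axioms and the requirement that constants form a ring homomorphism
-- K → K[x].  `p ∼ q` is equality of polynomials (formal, not functional).

module Poly {c ℓ} (K : CommutativeRing c ℓ) where
  open CommutativeRing K using (Carrier; _≈_; _+_; _*_; -_; 0#; 1#)

  infixl 6 _⊕_
  infixl 7 _⊗_
  infix  8 ⊝_
  infix  4 _∼_

  data Expr (m : ℕ) : Set c where
    var  : Fin m → Expr m
    con  : Carrier → Expr m
    _⊕_  : Expr m → Expr m → Expr m
    _⊗_  : Expr m → Expr m → Expr m
    ⊝_   : Expr m → Expr m

  data _∼_ {m : ℕ} : Expr m → Expr m → Set (c ⊔ ℓ) where
    ∼-refl  : ∀ {p} → p ∼ p
    ∼-sym   : ∀ {p q} → p ∼ q → q ∼ p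
    ∼-trans : ∀ {p q r} → p ∼ q → q ∼ r → p ∼ r
    ⊕-cong  : ∀ {p p′ q q′} → p ∼ p′ → q ∼ q′ → p ⊕ q ∼ p′ ⊕ q′
    ⊗-cong  : ∀ {p p′ q q′} → p ∼ p′ → q ∼ q′ → p ⊗ q ∼ p′ ⊗ q′
    ⊝-cong  : ∀ {p p′} → p ∼ p′ → ⊝ p ∼ ⊝ p′
    ∼⊕-assoc : ∀ p q r → (p ⊕ q) ⊕ r ∼ p ⊕ (q ⊕ r)
    ∼⊕-comm  : ∀ p q → p ⊕ q ∼ q ⊕ p
    ∼⊕-idˡ   : ∀ p → con 0# ⊕ p ∼ p
    ∼⊝-invˡ  : ∀ p → ⊝ p ⊕ p ∼ con 0#
    ∼⊗-assoc : ∀ p q r → (p ⊗ q) ⊗ r ∼ p ⊗ (q ⊗ r)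
    ∼⊗-comm  : ∀ p q → p ⊗ q ∼ q ⊗ p
    ∼⊗-idˡ   : ∀ p → con 1# ⊗ p ∼ p
    ∼-distribˡ : ∀ p q r → p ⊗ (q ⊕ r) ∼ p ⊗ q ⊕ p ⊗ r
    con-≈   : ∀ {x y} → x ≈ y → con x ∼ con y
    con-+   : ∀ x y → con (x + y) ∼ con x ⊕ con y
    con-*   : ∀ x y → con (x * y) ∼ con x ⊗ con y
    con--   : ∀ x → con (- x) ∼ ⊝ con x

  _[_] : ∀ {m k} → Expr m → (Fin m → Expr k) → Expr k
  var i   [ σ ] = σ i
  con x   [ σ ] = con x
  (p ⊕ q) [ σ ] = p [ σ ] ⊕ q [ σ ]
  (p ⊗ q) [ σ ] = p [ σ ] ⊗ q [ σ ]
  (⊝ p)   [ σ ] = ⊝ (p [ σ ])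

  ℕ→K : ℕ → Carrier
  ℕ→K zero    = 0#
  ℕ→K (suc k) = 1# + ℕ→K k

  ℤ→K : ℤ → Carrier
  ℤ→K (+ k)      = ℕ→K k
  ℤ→K -[1+ k ]   = - ℕ→K (suc k)

  evalRow : ∀ {m} → Row → Expr m → Expr m
  evalRow []       y = con 0#
  evalRow (z ∷ zs) y = con (ℤ→K z) ⊕ y ⊗ evalRow zs y

  evalZ : ∀ {m} → ZPoly → Expr m → Expr m → Expr m
  evalZ []       x y = con 0#
  evalZ (r ∷ rs) x y = evalRow r y ⊕ x ⊗ evalZ rs x y

  𝑎 𝑏 𝜆 𝜇 : Expr 4
  𝑎 = var zero
  𝑏 = var (suc zero)
  𝜆 = var (suc (suc zero))
  𝜇 = var (suc (suc (suc zero)))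

  D c4 c6 : Index → Expr 4 → Expr 4 → Expr 4
  D  n = evalZ (DZ n)
  c4 n = evalZ (c4Z n)
  c6 n = evalZ (c6Z n)

  X Y : Index → Expr 4
  X n = 𝜆 ⊗ 𝑎 ⊕ ⊝ (𝜇 ⊗ evalZ (∂b (DZ n)) 𝑎 𝑏)
  Y n = 𝜆 ⊗ 𝑏 ⊕ 𝜇 ⊗ evalZ (∂a (DZ n)) 𝑎 𝑏

  -- P ↦ P(c4(a,b), c6(a,b), λ, μ): an element of K[c4,c6][λ,μ] ⊆ K[a,b,λ,μ]
  atC : Index → Fin 4 → Expr 4
  atC n zero                      = c4 n 𝑎 𝑏
  atC n (suc zero)                = c6 n 𝑎 𝑏
  atC n (suc (suc zero))          = 𝜆
  atC n (suc (suc (suc zero)))    = 𝜇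

  InKc4c6 : Index → Expr 4 → Set (c ⊔ ℓ)
  InKc4c6 n F = ∃ λ (P : Expr 4) → F ∼ P [ atC n ]

  QuotInKc4c6 : Index → Set (c ⊔ ℓ)
  QuotInKc4c6 n = ∃ λ (P : Expr 4) → D n (X n) (Y n) ∼ D n 𝑎 𝑏 ⊗ (P [ atC n ])

-- Each of the three polynomials equals an explicit polynomial in c₄, c₆, λ, μ with integer
-- coefficients (the certificates below; for n = 2 the quotient is λ³ - 3c₄λμ² - 2c₆μ³).
-- Since D, c₄ and c₆ have integer coefficients, each claim is the image under ℤ → K of a
-- polynomial identity over ℤ, which is checked by computation with a normaliser for sparse
-- integer polynomials that is proved sound in every commutative ring.
module Submission where

open import Level using (_⊔_)
open import Function using (_∘_)
open import Algebra.Bundles using (CommutativeRing; RawRing)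
open import Algebra.Morphism.Structures using (IsRingHomomorphism)
open import Algebra.Morphism.Construct.Composition using (isRingHomomorphism)
open import Data.Fin using (Fin; zero; suc)
open import Data.Integer as ℤ using (ℤ; +_; -[1+_]; _⊖_; _◃_; sign; ∣_∣)
open import Data.Integer.Properties using ([1+m]⊖[1+n]≡m⊖n; ◃-inverse)
open import Data.List using (List; []; _∷_)
open import Data.Nat as ℕ using (ℕ; zero; suc)
open import Data.Nat.Properties as ℕ using (+-suc)
open import Data.Product using (_×_; _,_)
open import Data.Sign as Sign using (Sign)
open import Data.Vec as Vec using (Vec; []; _∷_; zipWith; replicate; lookup)
open import Data.Vec.Properties using (lookup-map)
open import Data.Vec.Relation.Binary.Pointwise.Inductive using (Pointwise; Pointwise-≡⇒≡)
import Data.Vec.Relation.Binary.Lex.Strict as Lex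
open Lex using (Lex-<)
open import Relation.Binary.Definitions using (Trichotomous; tri<; tri≈; tri>)
open import Relation.Nullary using (¬_)
open import Relation.Binary.PropositionalEquality as ≡ using (_≡_; cong; cong₂)
import Relation.Binary.Reasoning.Setoid
open import Tactic.RingSolver.Core.Expression using (Expr; Κ; Ι; _⊕_; _⊗_; _⊛_; ⊝_; module Eval)
open import Defs

module IntegerCast {c ℓ} (K : CommutativeRing c ℓ) where
  open CommutativeRing K
  open import Algebra.Definitions.RawMonoid +-rawMonoid using () renaming (_×_ to _·_)
  open import Algebra.Properties.Semiring.Mult semiring using (×-homo-+; ×1-homo-*)
  open import Algebra.Properties.Ring ring using (-1*x≈-x; -‿involutive; -0#≈0#; -‿+-comm)
  open import Algebra.Properties.CommutativeSemigroup *-commutativeSemigroup using (interchange)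
  open import Algebra.Properties.CommutativeSemigroup +-commutativeSemigroup
    using () renaming (interchange to +-interchange)
  open import Relation.Binary.Reasoning.Setoid setoid
  open Poly K using (ℕ→K; ℤ→K)

  ℕ→K≡·1# : ∀ n → ℕ→K n ≡ n · 1#
  ℕ→K≡·1# zero    = ≡.refl
  ℕ→K≡·1# (suc n) = cong (λ x → 1# + x) (ℕ→K≡·1# n)

  ℕ→K-homo-+ : ∀ m n → ℕ→K (m ℕ.+ n) ≈ ℕ→K m + ℕ→K n
  ℕ→K-homo-+ m n = begin
    ℕ→K (m ℕ.+ n)      ≡⟨ ℕ→K≡·1# (m ℕ.+ n) ⟩
    (m ℕ.+ n) · 1#      ≈⟨ ×-homo-+ 1# m n ⟩
    m · 1# + n · 1#     ≡⟨ cong₂ _+_ (≡.sym (ℕ→K≡·1# m)) (≡.sym (ℕ→K≡·1# n)) ⟩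
    ℕ→K m + ℕ→K n       ∎

  ℕ→K-homo-* : ∀ m n → ℕ→K (m ℕ.* n) ≈ ℕ→K m * ℕ→K n
  ℕ→K-homo-* m n = begin
    ℕ→K (m ℕ.* n)          ≡⟨ ℕ→K≡·1# (m ℕ.* n) ⟩
    (m ℕ.* n) · 1#          ≈⟨ ×1-homo-* m n ⟩
    (m · 1#) * (n · 1#)     ≡⟨ cong₂ _*_ (≡.sym (ℕ→K≡·1# m)) (≡.sym (ℕ→K≡·1# n)) ⟩
    ℕ→K m * ℕ→K n           ∎

  ℤ→K-homo-⊖ : ∀ m n → ℤ→K (m ⊖ n) ≈ ℕ→K m - ℕ→K n
  ℤ→K-homo-⊖ m       zero    = trans (sym (+-identityʳ _)) (+-cong refl (sym -0#≈0#))
  ℤ→K-homo-⊖ zero    (suc n) = sym (+-identityˡ _)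
  ℤ→K-homo-⊖ (suc m) (suc n) = begin
    ℤ→K (suc m ⊖ suc n)          ≡⟨ cong ℤ→K ([1+m]⊖[1+n]≡m⊖n m n) ⟩
    ℤ→K (m ⊖ n)                  ≈⟨ ℤ→K-homo-⊖ m n ⟩
    ℕ→K m - ℕ→K n                ≈⟨ sym (z+x-[z+y]≈x-y 1# (ℕ→K m) (ℕ→K n)) ⟩
    (1# + ℕ→K m) - (1# + ℕ→K n)  ∎
    where
    z+x-[z+y]≈x-y : ∀ z x y → (z + x) - (z + y) ≈ x - y
    z+x-[z+y]≈x-y z x y = begin
      (z + x) + - (z + y)   ≈⟨ +-cong refl (sym (-‿+-comm z y)) ⟩
      (z + x) + (- z + - y) ≈⟨ +-interchange z x (- z) (- y) ⟩
      (z + - z) + (x - y)   ≈⟨ +-cong (-‿inverseʳ z) refl ⟩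
      0# + (x - y)          ≈⟨ +-identityˡ _ ⟩
      x - y                 ∎

  ℤ→K-homo-neg : ∀ i → ℤ→K (ℤ.- i) ≈ - ℤ→K i
  ℤ→K-homo-neg -[1+ n ]    = sym (-‿involutive _)
  ℤ→K-homo-neg (+ zero)    = sym -0#≈0#
  ℤ→K-homo-neg (+ (suc n)) = refl

  ℤ→K-homo-+ : ∀ i j → ℤ→K (i ℤ.+ j) ≈ ℤ→K i + ℤ→K j
  ℤ→K-homo-+ -[1+ m ] -[1+ n ] = begin
    - ℕ→K (suc (suc (m ℕ.+ n)))             ≡⟨ cong (λ k → - ℕ→K (suc k)) (≡.sym (+-suc m n)) ⟩
    - ℕ→K (suc m ℕ.+ suc n)                 ≈⟨ -‿cong (ℕ→K-homo-+ (suc m) (suc n)) ⟩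
    - (ℕ→K (suc m) + ℕ→K (suc n))           ≈⟨ sym (-‿+-comm _ _) ⟩
    - ℕ→K (suc m) + - ℕ→K (suc n)           ∎
  ℤ→K-homo-+ -[1+ m ] (+ n)    = trans (ℤ→K-homo-⊖ n (suc m)) (+-comm _ _)
  ℤ→K-homo-+ (+ m)    -[1+ n ] = ℤ→K-homo-⊖ m (suc n)
  ℤ→K-homo-+ (+ m)    (+ n)    = ℕ→K-homo-+ m n

  Sign→K : Sign → Carrier
  Sign→K Sign.+ = 1#
  Sign→K Sign.- = - 1#

  Sign→K-homo-* : ∀ s t → Sign→K (s Sign.* t) ≈ Sign→K s * Sign→K t
  Sign→K-homo-* Sign.+ Sign.+ = sym (*-identityˡ 1#)
  Sign→K-homo-* Sign.+ Sign.- = sym (*-identityˡ (- 1#))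
  Sign→K-homo-* Sign.- Sign.+ = sym (*-identityʳ (- 1#))
  Sign→K-homo-* Sign.- Sign.- = sym (trans (-1*x≈-x (- 1#)) (-‿involutive 1#))

  ℤ→K-◃ : ∀ s n → ℤ→K (s ◃ n) ≈ Sign→K s * ℕ→K n
  ℤ→K-◃ s      zero    = sym (zeroʳ _)
  ℤ→K-◃ Sign.+ (suc n) = sym (*-identityˡ _)
  ℤ→K-◃ Sign.- (suc n) = sym (-1*x≈-x _)

  ℤ→K≈sign*abs : ∀ i → ℤ→K i ≈ Sign→K (sign i) * ℕ→K ∣ i ∣
  ℤ→K≈sign*abs i = begin
    ℤ→K i                 ≡⟨ cong ℤ→K (≡.sym (◃-inverse i)) ⟩
    ℤ→K (sign i ◃ ∣ i ∣)  ≈⟨ ℤ→K-◃ (sign i) ∣ i ∣ ⟩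
    Sign→K (sign i) * ℕ→K ∣ i ∣ ∎

  ℤ→K-homo-* : ∀ i j → ℤ→K (i ℤ.* j) ≈ ℤ→K i * ℤ→K j
  ℤ→K-homo-* i j = begin
    ℤ→K (sign i Sign.* sign j ◃ ∣ i ∣ ℕ.* ∣ j ∣)
      ≈⟨ ℤ→K-◃ (sign i Sign.* sign j) (∣ i ∣ ℕ.* ∣ j ∣) ⟩
    Sign→K (sign i Sign.* sign j) * ℕ→K (∣ i ∣ ℕ.* ∣ j ∣)
      ≈⟨ *-cong (Sign→K-homo-* (sign i) (sign j)) (ℕ→K-homo-* ∣ i ∣ ∣ j ∣) ⟩
    (Sign→K (sign i) * Sign→K (sign j)) * (ℕ→K ∣ i ∣ * ℕ→K ∣ j ∣)
      ≈⟨ interchange _ _ _ _ ⟩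
    (Sign→K (sign i) * ℕ→K ∣ i ∣) * (Sign→K (sign j) * ℕ→K ∣ j ∣)
      ≈⟨ *-cong (ℤ→K≈sign*abs i) (ℤ→K≈sign*abs j) ⟨
    ℤ→K i * ℤ→K j ∎

  ℤ→K-isRingHomomorphism : IsRingHomomorphism ℤ.+-*-rawRing rawRing ℤ→K
  ℤ→K-isRingHomomorphism = record
    { isSemiringHomomorphism = record
      { isNearSemiringHomomorphism = record
        { +-isMonoidHomomorphism = record
          { isMagmaHomomorphism = record
            { isRelHomomorphism = record { cong = λ i≡j → reflexive (cong ℤ→K i≡j) }
            ; homo = ℤ→K-homo-+ }
          ; ε-homo = refl }
        ; *-homo = ℤ→K-homo-* }
      ; 1#-homo = +-identityʳ 1# }
    ; -‿homo = ℤ→K-homo-neg }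

module SparseNormalForm where

  Monomial : ℕ → Set
  Monomial = Vec ℕ

  -- Σ k xᵅ with the α strictly decreasing lexicographically and every k ≠ 0.  Only soundness is
  -- proved below.
  NF : ℕ → Set
  NF m = List (ℤ × Monomial m)

  <-lex-cmp : ∀ {m} → Trichotomous (Pointwise _≡_) (Lex-< _≡_ ℕ._<_ {m})
  <-lex-cmp = Lex.<-cmp ≡.sym ℕ.<-cmp

  consᴺ : ∀ {m} → ℤ → Monomial m → NF m → NF m
  consᴺ (+ zero) α p = p
  consᴺ k        α p = (k , α) ∷ p

  infixl 6 _+ᴺ_
  infixl 7 _*ᴺ_ _·ᴺ_
  infix  8 -ᴺ_
  infixr 8 _^ᴺ_

  _+ᴺ_  : ∀ {m} → NF m → NF m → NF m
  merge : ∀ {m} → ℤ × Monomial m → NF m → NF m → NF m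

  []      +ᴺ q = q
  (t ∷ p) +ᴺ q = merge t p q

  merge t p [] = t ∷ p
  merge (k , α) p ((l , β) ∷ q) with <-lex-cmp α β
  ... | tri< _ _ _ = (l , β) ∷ merge (k , α) p q
  ... | tri≈ _ _ _ = consᴺ (k ℤ.+ l) α (p +ᴺ q)
  ... | tri> _ _ _ = (k , α) ∷ (p +ᴺ ((l , β) ∷ q))

  _·ᴺ_ : ∀ {m} → ℤ × Monomial m → NF m → NF m
  t       ·ᴺ []            = []
  (k , α) ·ᴺ ((l , β) ∷ q) = (k ℤ.* l , zipWith ℕ._+_ α β) ∷ (k , α) ·ᴺ q

  _*ᴺ_ : ∀ {m} → NF m → NF m → NF m
  []      *ᴺ q = []
  (t ∷ p) *ᴺ q = t ·ᴺ q +ᴺ p *ᴺ q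

  -ᴺ_ : ∀ {m} → NF m → NF m
  -ᴺ []            = []
  -ᴺ ((k , α) ∷ p) = (ℤ.- k , α) ∷ -ᴺ p

  constᴺ : ∀ {m} → ℤ → NF m
  constᴺ k = consᴺ k (replicate _ 0) []

  unit : ∀ {m} → Fin m → Monomial m
  unit zero    = 1 ∷ replicate _ 0
  unit (suc i) = 0 ∷ unit i

  -- The clauses follow those of _^′_, which interprets _⊛_.
  _^ᴺ_ : ∀ {m} → NF m → ℕ → NF m
  p ^ᴺ zero          = constᴺ (+ 1)
  p ^ᴺ suc zero      = p
  p ^ᴺ suc (suc n)   = p ^ᴺ suc n *ᴺ p

  normalise : ∀ {m} → Expr ℤ m → NF m
  normalise (Κ k)   = constᴺ k
  normalise (Ι i)   = (+ 1 , unit i) ∷ []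
  normalise (e ⊕ f) = normalise e +ᴺ normalise f
  normalise (e ⊗ f) = normalise e *ᴺ normalise f
  normalise (⊝ e)   = -ᴺ normalise e
  normalise (e ⊛ n) = normalise e ^ᴺ n

open SparseNormalForm using (normalise)

module SparseNormalFormSoundness
  {c ℓ} (S : CommutativeRing c ℓ) {φ : ℤ → CommutativeRing.Carrier S}
  (φ-isRingHomomorphism : IsRingHomomorphism ℤ.+-*-rawRing (CommutativeRing.rawRing S) φ)
  where

  open SparseNormalForm hiding (normalise)
  open CommutativeRing S
  open IsRingHomomorphism φ-isRingHomomorphism using (+-homo; *-homo; -‿homo; 0#-homo; 1#-homo)
  open import Algebra.Properties.Semiring.Exp semiring using (_^_; ^-homo-*)
  open import Algebra.Properties.Semiring.Exp.TCOptimised semiring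
    using () renaming (_^_ to _^′_; ^-congˡ to ^′-congˡ)
  open import Algebra.Properties.Ring ring using (-‿distribˡ-*; -‿+-comm; -0#≈0#; x∙y⁻¹≈ε⇒x≈y)
  open import Algebra.Properties.CommutativeSemigroup *-commutativeSemigroup using (interchange)
  open import Algebra.Properties.CommutativeSemigroup +-commutativeSemigroup
    using (x∙yz≈y∙xz) renaming (interchange to +-interchange)
  open import Relation.Binary.Reasoning.Setoid setoid
  open Eval rawRing φ

  monomial : ∀ {m} → Monomial m → Vec Carrier m → Carrier
  monomial []      []      = 1#
  monomial (i ∷ α) (x ∷ ρ) = x ^ i * monomial α ρ

  ⟦_⟧ᴺ : ∀ {m} → NF m → Vec Carrier m → Carrier
  ⟦ []            ⟧ᴺ ρ = 0#
  ⟦ (k , α) ∷ p   ⟧ᴺ ρ = φ k * monomial α ρ + ⟦ p ⟧ᴺ ρ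

  monomial-homo : ∀ {m} (α β : Monomial m) ρ →
                  monomial (zipWith ℕ._+_ α β) ρ ≈ monomial α ρ * monomial β ρ
  monomial-homo []      []      []      = sym (*-identityˡ 1#)
  monomial-homo (i ∷ α) (j ∷ β) (x ∷ ρ) = begin
    x ^ (i ℕ.+ j) * monomial (zipWith ℕ._+_ α β) ρ      ≈⟨ *-cong (^-homo-* x i j) (monomial-homo α β ρ) ⟩
    (x ^ i * x ^ j) * (monomial α ρ * monomial β ρ)     ≈⟨ interchange _ _ _ _ ⟩
    (x ^ i * monomial α ρ) * (x ^ j * monomial β ρ)     ∎

  monomial-0 : ∀ {m} (ρ : Vec Carrier m) → monomial (replicate m 0) ρ ≈ 1#
  monomial-0 []      = refl
  monomial-0 (x ∷ ρ) = trans (*-identityˡ _) (monomial-0 ρ)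

  monomial-unit : ∀ {m} (i : Fin m) ρ → monomial (unit i) ρ ≈ lookup ρ i
  monomial-unit zero    (x ∷ ρ) = trans (*-cong (*-identityʳ x) (monomial-0 ρ)) (*-identityʳ x)
  monomial-unit (suc i) (x ∷ ρ) = trans (*-identityˡ _) (monomial-unit i ρ)

  consᴺ-sound : ∀ {m} k α (p : NF m) ρ → ⟦ consᴺ k α p ⟧ᴺ ρ ≈ φ k * monomial α ρ + ⟦ p ⟧ᴺ ρ
  consᴺ-sound (+ zero)    α p ρ = begin
    ⟦ p ⟧ᴺ ρ                            ≈⟨ +-identityˡ _ ⟨
    0# + ⟦ p ⟧ᴺ ρ                       ≈⟨ +-cong (zeroˡ _) refl ⟨
    0# * monomial α ρ + ⟦ p ⟧ᴺ ρ        ≈⟨ +-cong (*-cong 0#-homo refl) refl ⟨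
    φ (+ 0) * monomial α ρ + ⟦ p ⟧ᴺ ρ   ∎
  consᴺ-sound (+ (suc _)) α p ρ = refl
  consᴺ-sound (ℤ.-[1+ _ ]) α p ρ = refl

  +ᴺ-sound  : ∀ {m} (p q : NF m) ρ → ⟦ p +ᴺ q ⟧ᴺ ρ ≈ ⟦ p ⟧ᴺ ρ + ⟦ q ⟧ᴺ ρ
  merge-sound : ∀ {m} t (p q : NF m) ρ → ⟦ merge t p q ⟧ᴺ ρ ≈ ⟦ t ∷ p ⟧ᴺ ρ + ⟦ q ⟧ᴺ ρ

  +ᴺ-sound []      q ρ = sym (+-identityˡ _)
  +ᴺ-sound (t ∷ p) q ρ = merge-sound t p q ρ

  merge-sound t p [] ρ = sym (+-identityʳ _)
  merge-sound (k , α) p ((l , β) ∷ q) ρ with <-lex-cmp α β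
  ... | tri< _ _ _ = trans (+-cong refl (merge-sound (k , α) p q ρ)) (x∙yz≈y∙xz _ _ _)
  ... | tri> _ _ _ = trans (+-cong refl (+ᴺ-sound p ((l , β) ∷ q) ρ)) (sym (+-assoc _ _ _))
  ... | tri≈ _ α≋β _ with Pointwise-≡⇒≡ α≋β
  ...   | ≡.refl = begin
    ⟦ consᴺ (k ℤ.+ l) α (p +ᴺ q) ⟧ᴺ ρ           ≈⟨ consᴺ-sound (k ℤ.+ l) α (p +ᴺ q) ρ ⟩
    φ (k ℤ.+ l) * M + ⟦ p +ᴺ q ⟧ᴺ ρ             ≈⟨ +-cong (*-cong (+-homo k l) refl) (+ᴺ-sound p q ρ) ⟩
    (φ k + φ l) * M + (⟦ p ⟧ᴺ ρ + ⟦ q ⟧ᴺ ρ)     ≈⟨ +-cong (distribʳ M (φ k) (φ l)) refl ⟩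
    (φ k * M + φ l * M) + (⟦ p ⟧ᴺ ρ + ⟦ q ⟧ᴺ ρ) ≈⟨ +-interchange _ _ _ _ ⟩
    (φ k * M + ⟦ p ⟧ᴺ ρ) + (φ l * M + ⟦ q ⟧ᴺ ρ) ∎
    where M = monomial α ρ

  ·ᴺ-sound : ∀ {m} k α (q : NF m) ρ → ⟦ (k , α) ·ᴺ q ⟧ᴺ ρ ≈ (φ k * monomial α ρ) * ⟦ q ⟧ᴺ ρ
  ·ᴺ-sound k α []            ρ = sym (zeroʳ _)
  ·ᴺ-sound k α ((l , β) ∷ q) ρ = begin
    φ (k ℤ.* l) * monomial (zipWith ℕ._+_ α β) ρ + ⟦ (k , α) ·ᴺ q ⟧ᴺ ρ
      ≈⟨ +-cong (*-cong (*-homo k l) (monomial-homo α β ρ)) (·ᴺ-sound k α q ρ) ⟩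
    (φ k * φ l) * (monomial α ρ * monomial β ρ) + (φ k * monomial α ρ) * ⟦ q ⟧ᴺ ρ
      ≈⟨ +-cong (interchange _ _ _ _) refl ⟩
    (φ k * monomial α ρ) * (φ l * monomial β ρ) + (φ k * monomial α ρ) * ⟦ q ⟧ᴺ ρ
      ≈⟨ distribˡ _ _ _ ⟨
    (φ k * monomial α ρ) * (φ l * monomial β ρ + ⟦ q ⟧ᴺ ρ) ∎

  *ᴺ-sound : ∀ {m} (p q : NF m) ρ → ⟦ p *ᴺ q ⟧ᴺ ρ ≈ ⟦ p ⟧ᴺ ρ * ⟦ q ⟧ᴺ ρ
  *ᴺ-sound []            q ρ = sym (zeroˡ _)
  *ᴺ-sound ((k , α) ∷ p) q ρ = begin
    ⟦ (k , α) ·ᴺ q +ᴺ p *ᴺ q ⟧ᴺ ρ                        ≈⟨ +ᴺ-sound ((k , α) ·ᴺ q) (p *ᴺ q) ρ ⟩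
    ⟦ (k , α) ·ᴺ q ⟧ᴺ ρ + ⟦ p *ᴺ q ⟧ᴺ ρ                  ≈⟨ +-cong (·ᴺ-sound k α q ρ) (*ᴺ-sound p q ρ) ⟩
    (φ k * monomial α ρ) * ⟦ q ⟧ᴺ ρ + ⟦ p ⟧ᴺ ρ * ⟦ q ⟧ᴺ ρ ≈⟨ distribʳ _ _ _ ⟨
    (φ k * monomial α ρ + ⟦ p ⟧ᴺ ρ) * ⟦ q ⟧ᴺ ρ           ∎

  -ᴺ-sound : ∀ {m} (p : NF m) ρ → ⟦ -ᴺ p ⟧ᴺ ρ ≈ - ⟦ p ⟧ᴺ ρ
  -ᴺ-sound []            ρ = sym -0#≈0#
  -ᴺ-sound ((k , α) ∷ p) ρ = begin
    φ (ℤ.- k) * monomial α ρ + ⟦ -ᴺ p ⟧ᴺ ρ ≈⟨ +-cong (*-cong (-‿homo k) refl) (-ᴺ-sound p ρ) ⟩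
    - φ k * monomial α ρ + - ⟦ p ⟧ᴺ ρ      ≈⟨ +-cong (-‿distribˡ-* _ _) refl ⟨
    - (φ k * monomial α ρ) + - ⟦ p ⟧ᴺ ρ    ≈⟨ -‿+-comm _ _ ⟩
    - (φ k * monomial α ρ + ⟦ p ⟧ᴺ ρ)      ∎

  constᴺ-sound : ∀ {m} k (ρ : Vec Carrier m) → ⟦ constᴺ k ⟧ᴺ ρ ≈ φ k
  constᴺ-sound k ρ = begin
    ⟦ constᴺ k ⟧ᴺ ρ                     ≈⟨ consᴺ-sound k (replicate _ 0) [] ρ ⟩
    φ k * monomial (replicate _ 0) ρ + 0# ≈⟨ +-identityʳ _ ⟩
    φ k * monomial (replicate _ 0) ρ    ≈⟨ *-cong refl (monomial-0 ρ) ⟩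
    φ k * 1#                            ≈⟨ *-identityʳ _ ⟩
    φ k                                 ∎

  ^ᴺ-sound : ∀ {m} (p : NF m) n ρ → ⟦ p ^ᴺ n ⟧ᴺ ρ ≈ ⟦ p ⟧ᴺ ρ ^′ n
  ^ᴺ-sound p zero          ρ = trans (constᴺ-sound (+ 1) ρ) 1#-homo
  ^ᴺ-sound p (suc zero)    ρ = refl
  ^ᴺ-sound p (suc (suc n)) ρ =
    trans (*ᴺ-sound (p ^ᴺ suc n) p ρ) (*-cong (^ᴺ-sound p (suc n) ρ) refl)

  normalise-sound : ∀ {m} (e : Expr ℤ m) ρ → ⟦ normalise e ⟧ᴺ ρ ≈ ⟦ e ⟧ ρ
  normalise-sound (Κ k)   ρ = constᴺ-sound k ρ
  normalise-sound (Ι i)   ρ = begin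
    φ (+ 1) * monomial (unit i) ρ + 0#  ≈⟨ +-identityʳ _ ⟩
    φ (+ 1) * monomial (unit i) ρ       ≈⟨ *-cong 1#-homo (monomial-unit i ρ) ⟩
    1# * lookup ρ i                     ≈⟨ *-identityˡ _ ⟩
    lookup ρ i                          ∎
  normalise-sound (e ⊕ f) ρ =
    trans (+ᴺ-sound (normalise e) (normalise f) ρ) (+-cong (normalise-sound e ρ) (normalise-sound f ρ))
  normalise-sound (e ⊗ f) ρ =
    trans (*ᴺ-sound (normalise e) (normalise f) ρ) (*-cong (normalise-sound e ρ) (normalise-sound f ρ))
  normalise-sound (⊝ e)   ρ = trans (-ᴺ-sound (normalise e) ρ) (-‿cong (normalise-sound e ρ))
  normalise-sound (e ⊛ n) ρ = trans (^ᴺ-sound (normalise e) n ρ) (^′-congˡ n (normalise-sound e ρ))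

  ≈-by-normalisation : ∀ {m} (e f : Expr ℤ m) → normalise (e ⊕ ⊝ f) ≡ [] → ∀ ρ → ⟦ e ⟧ ρ ≈ ⟦ f ⟧ ρ
  ≈-by-normalisation e f e-f≡[] ρ = x∙y⁻¹≈ε⇒x≈y _ _ (begin
    ⟦ e ⟧ ρ - ⟦ f ⟧ ρ        ≈⟨ normalise-sound (e ⊕ ⊝ f) ρ ⟨
    ⟦ normalise (e ⊕ ⊝ f) ⟧ᴺ ρ ≡⟨ ≡.cong (λ p → ⟦ p ⟧ᴺ ρ) e-f≡[] ⟩
    0#                       ∎)

infixl 9 _⟨_⟩

_⟨_⟩ : ∀ {a} {A : Set a} {k m} → Expr A k → Vec (Expr A m) k → Expr A m
Κ x     ⟨ τ ⟩ = Κ x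
Ι i     ⟨ τ ⟩ = lookup τ i
(e ⊕ f) ⟨ τ ⟩ = e ⟨ τ ⟩ ⊕ f ⟨ τ ⟩
(e ⊗ f) ⟨ τ ⟩ = e ⟨ τ ⟩ ⊗ f ⟨ τ ⟩
(⊝ e)   ⟨ τ ⟩ = ⊝ e ⟨ τ ⟩
(e ⊛ n) ⟨ τ ⟩ = e ⟨ τ ⟩ ⊛ n

module _ {ℓ₁ ℓ₂} (R : RawRing ℓ₁ ℓ₂) {a} {A : Set a} (⟦_⟧ᵣ : A → RawRing.Carrier R) where
  open RawRing R using (_+_; _*_; -_; rawSemiring)
  open import Algebra.Definitions.RawSemiring rawSemiring using (_^′_)
  open Eval R ⟦_⟧ᵣ

  ⟦⟧-⟨⟩ : ∀ {k m} (e : Expr A k) (τ : Vec (Expr A m) k) ρ →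
          ⟦ e ⟨ τ ⟩ ⟧ ρ ≡ ⟦ e ⟧ (Vec.map (λ t → ⟦ t ⟧ ρ) τ)
  ⟦⟧-⟨⟩ (Κ x)   τ ρ = ≡.refl
  ⟦⟧-⟨⟩ (Ι i)   τ ρ = ≡.sym (lookup-map i _ τ)
  ⟦⟧-⟨⟩ (e ⊕ f) τ ρ = cong₂ _+_ (⟦⟧-⟨⟩ e τ ρ) (⟦⟧-⟨⟩ f τ ρ)
  ⟦⟧-⟨⟩ (e ⊗ f) τ ρ = cong₂ _*_ (⟦⟧-⟨⟩ e τ ρ) (⟦⟧-⟨⟩ f τ ρ)
  ⟦⟧-⟨⟩ (⊝ e)   τ ρ = cong -_ (⟦⟧-⟨⟩ e τ ρ)
  ⟦⟧-⟨⟩ (e ⊛ n) τ ρ = cong (_^′ n) (⟦⟧-⟨⟩ e τ ρ)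

evalRowᴱ : ∀ {m} → Row → Expr ℤ m → Expr ℤ m
evalRowᴱ []      y = Κ (+ 0)
evalRowᴱ (z ∷ r) y = Κ z ⊕ y ⊗ evalRowᴱ r y

evalZᴱ : ∀ {m} → ZPoly → Expr ℤ m → Expr ℤ m → Expr ℤ m
evalZᴱ []      x y = Κ (+ 0)
evalZᴱ (r ∷ F) x y = evalRowᴱ r y ⊕ x ⊗ evalZᴱ F x y

module PolynomialRing {c ℓ} (K : CommutativeRing c ℓ) where
  open Poly K hiding (Expr; _⊕_; _⊗_; ⊝_)
  module P = Poly K

  polynomialRing : ℕ → CommutativeRing c (c ⊔ ℓ)
  polynomialRing m = record
    { Carrier = P.Expr m
    ; _≈_ = _∼_
    ; _+_ = P._⊕_
    ; _*_ = P._⊗_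
    ; -_ = P.⊝_
    ; 0# = con (CommutativeRing.0# K)
    ; 1# = con (CommutativeRing.1# K)
    ; isCommutativeRing = record
      { isRing = record
        { +-isAbelianGroup = record
          { isGroup = record
            { isMonoid = record
              { isSemigroup = record
                { isMagma = record
                  { isEquivalence = record { refl = ∼-refl ; sym = ∼-sym ; trans = ∼-trans }
                  ; ∙-cong = ⊕-cong }
                ; assoc = ∼⊕-assoc }
              ; identity = ∼⊕-idˡ , λ p → ∼-trans (∼⊕-comm p _) (∼⊕-idˡ p) }
            ; inverse = ∼⊝-invˡ , λ p → ∼-trans (∼⊕-comm p _) (∼⊝-invˡ p)
            ; ⁻¹-cong = ⊝-cong }
          ; comm = ∼⊕-comm }
        ; *-cong = ⊗-cong
        ; *-assoc = ∼⊗-assoc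
        ; *-identity = ∼⊗-idˡ , λ p → ∼-trans (∼⊗-comm p _) (∼⊗-idˡ p)
        ; distrib = ∼-distribˡ , λ p q r →
            ∼-trans (∼⊗-comm _ p) (∼-trans (∼-distribˡ p q r) (⊕-cong (∼⊗-comm p q) (∼⊗-comm p r))) }
      ; *-comm = ∼⊗-comm } }

  con-isRingHomomorphism : ∀ {m} →
    IsRingHomomorphism (CommutativeRing.rawRing K) (CommutativeRing.rawRing (polynomialRing m)) con
  con-isRingHomomorphism = record
    { isSemiringHomomorphism = record
      { isNearSemiringHomomorphism = record
        { +-isMonoidHomomorphism = record
          { isMagmaHomomorphism = record
            { isRelHomomorphism = record { cong = con-≈ }
            ; homo = con-+ }
          ; ε-homo = ∼-refl }
        ; *-homo = con-* }
      ; 1#-homo = ∼-refl }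
    ; -‿homo = con-- }

  open IntegerCast K using (ℤ→K-isRingHomomorphism)

  ℤ→K[X]-isRingHomomorphism : ∀ {m} →
    IsRingHomomorphism ℤ.+-*-rawRing (CommutativeRing.rawRing (polynomialRing m)) (con ∘ ℤ→K)
  ℤ→K[X]-isRingHomomorphism {m} =
    isRingHomomorphism (CommutativeRing.trans (polynomialRing m)) ℤ→K-isRingHomomorphism con-isRingHomomorphism

  module _ {m : ℕ} where
    open Eval (CommutativeRing.rawRing (polynomialRing m)) (con ∘ ℤ→K)

    ⟦⟧-[] : ∀ {k} (e : Expr ℤ k) (ρ : Vec (P.Expr m) k) (σ : Fin m → P.Expr m) →
            ⟦ e ⟧ ρ [ σ ] ≡ ⟦ e ⟧ (Vec.map (_[ σ ]) ρ)
    ⟦⟧-[] (Κ k)   ρ σ = ≡.refl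
    ⟦⟧-[] (Ι i)   ρ σ = ≡.sym (lookup-map i (_[ σ ]) ρ)
    ⟦⟧-[] (e ⊕ f) ρ σ = cong₂ P._⊕_ (⟦⟧-[] e ρ σ) (⟦⟧-[] f ρ σ)
    ⟦⟧-[] (e ⊗ f) ρ σ = cong₂ P._⊗_ (⟦⟧-[] e ρ σ) (⟦⟧-[] f ρ σ)
    ⟦⟧-[] (⊝ e)   ρ σ = cong P.⊝_ (⟦⟧-[] e ρ σ)
    ⟦⟧-[] (e ⊛ n) ρ σ = ≡.trans (^′-[] (⟦ e ⟧ ρ) n) (cong (_^′ n) (⟦⟧-[] e ρ σ))
      where
      open RawRing (CommutativeRing.rawRing (polynomialRing m)) using (rawSemiring)
      open import Algebra.Definitions.RawSemiring rawSemiring using (_^′_)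
      ^′-[] : ∀ p n → (p ^′ n) [ σ ] ≡ (p [ σ ]) ^′ n
      ^′-[] p zero          = ≡.refl
      ^′-[] p (suc zero)    = ≡.refl
      ^′-[] p (suc (suc n)) = cong (P._⊗ (p [ σ ])) (^′-[] p (suc n))

    ⟦evalRowᴱ⟧ : ∀ r (y : Expr ℤ m) ρ → ⟦ evalRowᴱ r y ⟧ ρ ≡ evalRow r (⟦ y ⟧ ρ)
    ⟦evalRowᴱ⟧ []      y ρ = ≡.refl
    ⟦evalRowᴱ⟧ (z ∷ r) y ρ = cong (λ t → con (ℤ→K z) P.⊕ ⟦ y ⟧ ρ P.⊗ t) (⟦evalRowᴱ⟧ r y ρ)

    ⟦evalZᴱ⟧ : ∀ F (x y : Expr ℤ m) ρ → ⟦ evalZᴱ F x y ⟧ ρ ≡ evalZ F (⟦ x ⟧ ρ) (⟦ y ⟧ ρ)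
    ⟦evalZᴱ⟧ []      x y ρ = ≡.refl
    ⟦evalZᴱ⟧ (r ∷ F) x y ρ =
      cong₂ (λ s t → s P.⊕ ⟦ x ⟧ ρ P.⊗ t) (⟦evalRowᴱ⟧ r y ρ) (⟦evalZᴱ⟧ F x y ρ)

𝑎ᴱ 𝑏ᴱ 𝜆ᴱ 𝜇ᴱ : Expr ℤ 4
𝑎ᴱ = Ι zero
𝑏ᴱ = Ι (suc zero)
𝜆ᴱ = Ι (suc (suc zero))
𝜇ᴱ = Ι (suc (suc (suc zero)))

Xᴱ Yᴱ : Index → Expr ℤ 4
Xᴱ n = 𝜆ᴱ ⊗ 𝑎ᴱ ⊕ ⊝ (𝜇ᴱ ⊗ evalZᴱ (∂b (DZ n)) 𝑎ᴱ 𝑏ᴱ)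
Yᴱ n = 𝜆ᴱ ⊗ 𝑏ᴱ ⊕ 𝜇ᴱ ⊗ evalZᴱ (∂a (DZ n)) 𝑎ᴱ 𝑏ᴱ

atCᴱ : Index → Vec (Expr ℤ 4) 4
atCᴱ n = evalZᴱ (c4Z n) 𝑎ᴱ 𝑏ᴱ ∷ evalZᴱ (c6Z n) 𝑎ᴱ 𝑏ᴱ ∷ 𝜆ᴱ ∷ 𝜇ᴱ ∷ []

IsCertificate : Index → ZPoly → Expr ℤ 4 → Set
IsCertificate n F e = normalise (evalZᴱ F (Xᴱ n) (Yᴱ n) ⊕ ⊝ e ⟨ atCᴱ n ⟩) ≡ []

IsQuotientCertificate : Index → Expr ℤ 4 → Set
IsQuotientCertificate n e =
  normalise (evalZᴱ (DZ n) (Xᴱ n) (Yᴱ n) ⊕ ⊝ (evalZᴱ (DZ n) 𝑎ᴱ 𝑏ᴱ ⊗ e ⟨ atCᴱ n ⟩)) ≡ []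

module Certificates where
  open import Data.Integer using (-_)

  -- Polynomials in the variables (c₄, c₆, λ, μ) of atC: (k , i , j , p , q) stands for k c₄ⁱ c₆ʲ λᵖ μ^q.
  Term : Set
  Term = ℤ × ℕ × ℕ × ℕ × ℕ

  certificate : List Term → Expr ℤ 4
  certificate []                         = Κ (+ 0)
  certificate ((k , i , j , p , q) ∷ ts) =
    Κ k ⊗ (Ι zero ⊛ i ⊗ Ι (suc zero) ⊛ j ⊗ Ι (suc (suc zero)) ⊛ p ⊗ Ι (suc (suc (suc zero))) ⊛ q)
      ⊕ certificate ts

  D-quotient-certificate : Index → List Term
  D-quotient-certificate two =
    (- + 2 , 0 , 1 , 0 , 3) ∷
    (- + 3 , 1 , 0 , 1 , 2) ∷
    (+ 1   , 0 , 0 , 3 , 0) ∷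
    []
  D-quotient-certificate three =
    (- + 3 , 2 , 0 , 0 , 4) ∷
    (- + 8 , 0 , 1 , 1 , 3) ∷
    (- + 6 , 1 , 0 , 2 , 2) ∷
    (+ 1   , 0 , 0 , 4 , 0) ∷
    []
  D-quotient-certificate four =
    (- + 32 , 0 , 2 , 0 , 6) ∷
    (+ 27   , 3 , 0 , 0 , 6) ∷
    (- + 24 , 1 , 1 , 1 , 5) ∷
    (- + 45 , 2 , 0 , 2 , 4) ∷
    (- + 40 , 0 , 1 , 3 , 3) ∷
    (- + 15 , 1 , 0 , 4 , 2) ∷
    (+ 1    , 0 , 0 , 6 , 0) ∷
    []
  D-quotient-certificate five =
    (+ 102400   , 0 , 4 , 0 , 12) ∷
    (- + 193536 , 3 , 2 , 0 , 12) ∷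
    (+ 91125    , 6 , 0 , 0 , 12) ∷
    (+ 61440    , 1 , 3 , 1 , 11) ∷
    (- + 61560  , 4 , 1 , 1 , 11) ∷
    (+ 133056   , 2 , 2 , 2 , 10) ∷
    (- + 133650 , 5 , 0 , 2 , 10) ∷
    (+ 140800   , 0 , 3 , 3 , 9) ∷
    (- + 142560 , 3 , 1 , 3 , 9) ∷
    (+ 63360    , 1 , 2 , 4 , 8) ∷
    (- + 66825  , 4 , 0 , 4 , 8) ∷
    (- + 4752   , 2 , 1 , 5 , 7) ∷
    (- + 10560  , 0 , 2 , 6 , 6) ∷
    (+ 5940     , 3 , 0 , 6 , 6) ∷
    (- + 3168   , 1 , 1 , 7 , 5) ∷
    (- + 1485   , 2 , 0 , 8 , 4) ∷
    (- + 440    , 0 , 1 , 9 , 3) ∷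
    (- + 66     , 1 , 0 , 10 , 2) ∷
    (+ 1        , 0 , 0 , 12 , 0) ∷
    []

  c4-certificate : Index → List Term
  c4-certificate two =
    (+ 1 , 2 , 0 , 0 , 2) ∷
    (+ 2 , 0 , 1 , 1 , 1) ∷
    (+ 1 , 1 , 0 , 2 , 0) ∷
    []
  c4-certificate three =
    (+ 4   , 0 , 2 , 0 , 4) ∷
    (- + 3 , 3 , 0 , 0 , 4) ∷
    (+ 4   , 1 , 1 , 1 , 3) ∷
    (+ 6   , 2 , 0 , 2 , 2) ∷
    (+ 4   , 0 , 1 , 3 , 1) ∷
    (+ 1   , 1 , 0 , 4 , 0) ∷
    []
  c4-certificate four =
    (- + 80  , 2 , 2 , 0 , 8) ∷
    (+ 81    , 5 , 0 , 0 , 8) ∷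
    (- + 256 , 0 , 3 , 1 , 7) ∷
    (+ 264   , 3 , 1 , 1 , 7) ∷
    (- + 224 , 1 , 2 , 2 , 6) ∷
    (+ 252   , 4 , 0 , 2 , 6) ∷
    (+ 56    , 2 , 1 , 3 , 5) ∷
    (+ 112   , 0 , 2 , 4 , 4) ∷
    (- + 42  , 3 , 0 , 4 , 4) ∷
    (+ 56    , 1 , 1 , 5 , 3) ∷
    (+ 28    , 2 , 0 , 6 , 2) ∷
    (+ 8     , 0 , 1 , 7 , 1) ∷
    (+ 1     , 1 , 0 , 8 , 0) ∷
    []
  c4-certificate five =
    (- + 180224000  , 2 , 6 , 0 , 20) ∷
    (+ 544997376    , 5 , 4 , 0 , 20) ∷
    (- + 549301500  , 8 , 2 , 0 , 20) ∷
    (+ 184528125    , 11 , 0 , 0 , 20) ∷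
    (- + 655360000  , 0 , 7 , 1 , 19) ∷
    (+ 2005401600   , 3 , 5 , 1 , 19) ∷
    (- + 2044414080 , 6 , 3 , 1 , 19) ∷
    (+ 694372500    , 9 , 1 , 1 , 19) ∷
    (- + 622592000  , 1 , 6 , 2 , 18) ∷
    (+ 2026391040   , 4 , 4 , 2 , 18) ∷
    (- + 2182917600 , 7 , 2 , 2 , 18) ∷
    (+ 779118750    , 10 , 0 , 2 , 18) ∷
    (+ 361881600    , 2 , 5 , 3 , 17) ∷
    (- + 715080960  , 5 , 3 , 3 , 17) ∷
    (+ 353200500    , 8 , 1 , 3 , 17) ∷
    (+ 583680000    , 0 , 6 , 4 , 16) ∷
    (- + 1220474880 , 3 , 4 , 4 , 16) ∷
    (+ 714711600    , 6 , 2 , 4 , 16) ∷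
    (- + 77911875   , 9 , 0 , 4 , 16) ∷
    (+ 466944000    , 1 , 5 , 5 , 15) ∷
    (- + 882458496  , 4 , 3 , 5 , 15) ∷
    (+ 415530000    , 7 , 1 , 5 , 15) ∷
    (+ 287462400    , 2 , 4 , 6 , 14) ∷
    (- + 495188640  , 5 , 2 , 6 , 14) ∷
    (+ 207765000    , 8 , 0 , 6 , 14) ∷
    (+ 58368000     , 0 , 5 , 7 , 13) ∷
    (- + 23201280   , 3 , 3 , 7 , 13) ∷
    (- + 35089200   , 6 , 1 , 7 , 13) ∷
    (+ 37939200     , 1 , 4 , 8 , 12) ∷
    (+ 7202520      , 4 , 2 , 8 , 12) ∷
    (- + 45015750   , 7 , 0 , 8 , 12) ∷
    (+ 54853760     , 2 , 3 , 9 , 11) ∷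
    (- + 54685800   , 5 , 1 , 9 , 11) ∷
    (+ 15808000     , 0 , 4 , 10 , 10) ∷
    (- + 5619744    , 3 , 2 , 10 , 10) ∷
    (- + 10003500   , 6 , 0 , 10 , 10) ∷
    (+ 7904000      , 1 , 3 , 11 , 9) ∷
    (- + 7736040    , 4 , 1 , 11 , 9) ∷
    (+ 1126320      , 2 , 2 , 12 , 8) ∷
    (- + 1000350    , 5 , 0 , 12 , 8) ∷
    (- + 182400     , 0 , 3 , 13 , 7) ∷
    (+ 259920       , 3 , 1 , 13 , 7) ∷
    (- + 63840      , 1 , 2 , 14 , 6) ∷
    (+ 102600       , 4 , 0 , 14 , 6) ∷
    (+ 15504        , 2 , 1 , 15 , 5) ∷
    (+ 5700         , 0 , 2 , 16 , 4) ∷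
    (- + 855        , 3 , 0 , 16 , 4) ∷
    (+ 1140         , 1 , 1 , 17 , 3) ∷
    (+ 190          , 2 , 0 , 18 , 2) ∷
    (+ 20           , 0 , 1 , 19 , 1) ∷
    (+ 1            , 1 , 0 , 20 , 0) ∷
    []

  c6-certificate : Index → List Term
  c6-certificate two =
    (+ 2   , 0 , 2 , 0 , 3) ∷
    (- + 1 , 3 , 0 , 0 , 3) ∷
    (+ 3   , 1 , 1 , 1 , 2) ∷
    (+ 3   , 2 , 0 , 2 , 1) ∷
    (+ 1   , 0 , 1 , 3 , 0) ∷
    []
  c6-certificate three =
    (- + 8  , 0 , 3 , 0 , 6) ∷
    (+ 9    , 3 , 1 , 0 , 6) ∷
    (- + 12 , 1 , 2 , 1 , 5) ∷
    (+ 18   , 4 , 0 , 1 , 5) ∷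
    (+ 15   , 2 , 1 , 2 , 4) ∷
    (+ 20   , 0 , 2 , 3 , 3) ∷
    (+ 15   , 1 , 1 , 4 , 2) ∷
    (+ 6    , 2 , 0 , 5 , 1) ∷
    (+ 1    , 0 , 1 , 6 , 0) ∷
    []
  c6-certificate four =
    (- + 1024 , 0 , 5 , 0 , 12) ∷
    (+ 2240   , 3 , 3 , 0 , 12) ∷
    (- + 1215 , 6 , 1 , 0 , 12) ∷
    (- + 1536 , 1 , 4 , 1 , 11) ∷
    (+ 4464   , 4 , 2 , 1 , 11) ∷
    (- + 2916 , 7 , 0 , 1 , 11) ∷
    (+ 4224   , 2 , 3 , 2 , 10) ∷
    (- + 4158 , 5 , 1 , 2 , 10) ∷
    (+ 5632   , 0 , 4 , 3 , 9) ∷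
    (- + 4224 , 3 , 2 , 3 , 9) ∷
    (- + 1188 , 6 , 0 , 3 , 9) ∷
    (+ 6336   , 1 , 3 , 4 , 8) ∷
    (- + 5841 , 4 , 1 , 4 , 8) ∷
    (+ 3168   , 2 , 2 , 5 , 7) ∷
    (- + 2376 , 5 , 0 , 5 , 7) ∷
    (+ 924    , 3 , 1 , 6 , 6) ∷
    (+ 792    , 4 , 0 , 7 , 5) ∷
    (+ 495    , 2 , 1 , 8 , 4) ∷
    (+ 176    , 0 , 2 , 9 , 3) ∷
    (+ 44     , 3 , 0 , 9 , 3) ∷
    (+ 66     , 1 , 1 , 10 , 2) ∷
    (+ 12     , 2 , 0 , 11 , 1) ∷
    (+ 1      , 0 , 1 , 12 , 0) ∷
    []
  c6-certificate five =
    (+ 3355443200000     , 0 , 11 , 0 , 30) ∷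
    (- + 17532190720000  , 3 , 9 , 0 , 30) ∷
    (+ 36574189977600    , 6 , 7 , 0 , 30) ∷
    (- + 38083944628224  , 9 , 5 , 0 , 30) ∷
    (+ 19796866155000    , 12 , 3 , 0 , 30) ∷
    (- + 4110363984375   , 15 , 1 , 0 , 30) ∷
    (+ 5033164800000     , 1 , 10 , 1 , 29) ∷
    (- + 31344427008000  , 4 , 8 , 1 , 29) ∷
    (+ 75042714746880    , 7 , 6 , 1 , 29) ∷
    (- + 87394892457600  , 10 , 4 , 1 , 29) ∷
    (+ 49873523512500    , 13 , 2 , 1 , 29) ∷
    (- + 11210083593750  , 16 , 0 , 1 , 29) ∷
    (- + 21438136320000  , 2 , 9 , 2 , 28) ∷
    (+ 85731449241600    , 5 , 7 , 2 , 28) ∷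
    (- + 128580522647040 , 8 , 5 , 2 , 28) ∷
    (+ 85719228804000    , 11 , 3 , 2 , 28) ∷
    (- + 21432019078125  , 14 , 1 , 2 , 28) ∷
    (- + 30408704000000  , 0 , 10 , 3 , 27) ∷
    (+ 111934439424000   , 3 , 8 , 3 , 27) ∷
    (- + 143803576074240 , 6 , 6 , 3 , 27) ∷
    (+ 63806176396800    , 9 , 4 , 3 , 27) ∷
    (+ 8104032382500     , 12 , 2 , 3 , 27) ∷
    (- + 9632368125000   , 15 , 0 , 3 , 27) ∷
    (- + 41051750400000  , 1 , 9 , 4 , 26) ∷
    (+ 163803539865600   , 4 , 7 , 4 , 26) ∷
    (- + 245438120632320 , 7 , 5 , 4 , 26) ∷
    (+ 163672057566000   , 10 , 3 , 4 , 26) ∷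
    (- + 40985726371875  , 13 , 1 , 4 , 26) ∷
    (- + 18216714240000  , 2 , 8 , 5 , 25) ∷
    (+ 71274600677376    , 5 , 6 , 5 , 25) ∷
    (- + 105528606261120 , 8 , 4 , 5 , 25) ∷
    (+ 70097953635000    , 11 , 2 , 5 , 25) ∷
    (- + 17627233668750  , 14 , 0 , 5 , 25) ∷
    (+ 5131468800000     , 0 , 9 , 6 , 24) ∷
    (- + 22779445248000  , 3 , 7 , 6 , 24) ∷
    (+ 35246094796800    , 6 , 5 , 6 , 24) ∷
    (- + 22687218914400  , 9 , 3 , 6 , 24) ∷
    (+ 5089101159375     , 12 , 1 , 6 , 24) ∷
    (+ 6157762560000     , 1 , 8 , 7 , 23) ∷
    (- + 30337884979200  , 4 , 6 , 7 , 23) ∷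
    (+ 49888700928000    , 7 , 4 , 7 , 23) ∷
    (- + 33414470973000  , 10 , 2 , 7 , 23) ∷
    (+ 7705894500000     , 13 , 0 , 7 , 23) ∷
    (- + 4573421568000   , 2 , 7 , 8 , 22) ∷
    (+ 7701051801600     , 5 , 5 , 8 , 22) ∷
    (- + 1724509423800   , 8 , 3 , 8 , 22) ∷
    (- + 1403114956875   , 11 , 1 , 8 , 22) ∷
    (- + 3278438400000   , 0 , 8 , 9 , 21) ∷
    (+ 5125838438400     , 3 , 6 , 9 , 21) ∷
    (- + 2709129888000   , 6 , 4 , 9 , 21) ∷
    (+ 3077188825500     , 9 , 2 , 9 , 21) ∷
    (- + 2215444668750   , 12 , 0 , 9 , 21) ∷
    (- + 3442360320000   , 1 , 7 , 10 , 20) ∷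
    (+ 3892110842880     , 4 , 5 , 10 , 20) ∷
    (+ 2424887357760     , 7 , 3 , 10 , 20) ∷
    (- + 2874607835625   , 10 , 1 , 10 , 20) ∷
    (- + 4290656256000   , 2 , 6 , 11 , 19) ∷
    (+ 8100765158400     , 5 , 4 , 11 , 19) ∷
    (- + 3481840250100   , 8 , 2 , 11 , 19) ∷
    (- + 328214025000    , 11 , 0 , 11 , 19) ∷
    (- + 778629120000    , 0 , 7 , 12 , 18) ∷
    (- + 303665356800    , 3 , 5 , 12 , 18) ∷
    (+ 2776512362400     , 6 , 3 , 12 , 18) ∷
    (- + 1694131392375   , 9 , 1 , 12 , 18) ∷
    (- + 700766208000    , 1 , 6 , 13 , 17) ∷
    (+ 935084908800      , 4 , 4 , 13 , 17) ∷
    (+ 77604382800       , 7 , 2 , 13 , 17) ∷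
    (- + 311803323750    , 10 , 0 , 13 , 17) ∷
    (- + 297825638400    , 2 , 5 , 14 , 16) ∷
    (+ 474659611200      , 5 , 3 , 14 , 16) ∷
    (- + 176688550125    , 8 , 1 , 14 , 16) ∷
    (- + 79420170240     , 3 , 4 , 15 , 15) ∷
    (+ 79575287760       , 6 , 2 , 15 , 15) ∷
    (- + 43045111800     , 4 , 3 , 16 , 14) ∷
    (+ 43190534475       , 7 , 1 , 16 , 14) ∷
    (- + 12044419200     , 2 , 4 , 17 , 13) ∷
    (+ 5235216300        , 5 , 2 , 17 , 13) ∷
    (+ 6928962750        , 8 , 0 , 17 , 13) ∷
    (- + 2433216000      , 0 , 5 , 18 , 12) ∷
    (- + 1612005600      , 3 , 3 , 18 , 12) ∷
    (+ 4131714825        , 6 , 1 , 18 , 12) ∷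
    (- + 1459929600      , 1 , 4 , 19 , 11) ∷
    (+ 1352475900        , 4 , 2 , 19 , 11) ∷
    (+ 162081000         , 7 , 0 , 19 , 11) ∷
    (- + 216588240       , 2 , 3 , 20 , 10) ∷
    (+ 246633255         , 5 , 1 , 20 , 10) ∷
    (+ 32016000          , 0 , 4 , 21 , 9) ∷
    (- + 42021000        , 3 , 2 , 21 , 9) ∷
    (+ 24312150          , 6 , 0 , 21 , 9) ∷
    (+ 14407200          , 1 , 3 , 22 , 8) ∷
    (- + 8554275         , 4 , 1 , 22 , 8) ∷
    (+ 3915000           , 2 , 2 , 23 , 7) ∷
    (- + 1879200         , 5 , 0 , 23 , 7) ∷
    (+ 156600            , 0 , 3 , 24 , 6) ∷
    (+ 437175            , 3 , 1 , 24 , 6) ∷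
    (+ 46980             , 1 , 2 , 25 , 5) ∷
    (+ 95526             , 4 , 0 , 25 , 5) ∷
    (+ 27405             , 2 , 1 , 26 , 4) ∷
    (+ 2900              , 0 , 2 , 27 , 3) ∷
    (+ 1160              , 3 , 0 , 27 , 3) ∷
    (+ 435               , 1 , 1 , 28 , 2) ∷
    (+ 30                , 2 , 0 , 29 , 1) ∷
    (+ 1                 , 0 , 1 , 30 , 0) ∷
    []

open Certificates using (certificate; D-quotient-certificate; c4-certificate; c6-certificate)

D-quotient-certified : ∀ n → IsQuotientCertificate n (certificate (D-quotient-certificate n))
D-quotient-certified two   = ≡.refl
D-quotient-certified three = ≡.refl
D-quotient-certified four  = ≡.refl
D-quotient-certified five  = ≡.refl

c4-certified : ∀ n → IsCertificate n (c4Z n) (certificate (c4-certificate n))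
c4-certified two   = ≡.refl
c4-certified three = ≡.refl
c4-certified four  = ≡.refl
c4-certified five  = ≡.refl

c6-certified : ∀ n → IsCertificate n (c6Z n) (certificate (c6-certificate n))
c6-certified two   = ≡.refl
c6-certified three = ≡.refl
c6-certified four  = ≡.refl
c6-certified five  = ≡.refl

module CertificateSoundness {c ℓ} (K : CommutativeRing c ℓ) where
  open Poly K hiding (Expr; _⊕_; _⊗_; ⊝_)
  open PolynomialRing K
  open CommutativeRing (polynomialRing 4) using (setoid; rawRing)
  open Eval rawRing (con ∘ ℤ→K)
  open SparseNormalFormSoundness (polynomialRing 4) ℤ→K[X]-isRingHomomorphism using (≈-by-normalisation)

  vars : Vec (P.Expr 4) 4
  vars = 𝑎 ∷ 𝑏 ∷ 𝜆 ∷ 𝜇 ∷ []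

  ⟦evalZᴱ⟧-at-XY : ∀ n F → ⟦ evalZᴱ F (Xᴱ n) (Yᴱ n) ⟧ vars ≡ evalZ F (X n) (Y n)
  ⟦evalZᴱ⟧-at-XY n F = begin
    ⟦ evalZᴱ F (Xᴱ n) (Yᴱ n) ⟧ vars              ≡⟨ ⟦evalZᴱ⟧ F (Xᴱ n) (Yᴱ n) vars ⟩
    evalZ F (⟦ Xᴱ n ⟧ vars) (⟦ Yᴱ n ⟧ vars)      ≡⟨ cong₂ (evalZ F) ⟦Xᴱ⟧ ⟦Yᴱ⟧ ⟩
    evalZ F (X n) (Y n)                          ∎
    where
    open ≡.≡-Reasoning
    ⟦Xᴱ⟧ : ⟦ Xᴱ n ⟧ vars ≡ X n
    ⟦Xᴱ⟧ = cong (λ t → 𝜆 P.⊗ 𝑎 P.⊕ P.⊝ (𝜇 P.⊗ t)) (⟦evalZᴱ⟧ (∂b (DZ n)) 𝑎ᴱ 𝑏ᴱ vars)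
    ⟦Yᴱ⟧ : ⟦ Yᴱ n ⟧ vars ≡ Y n
    ⟦Yᴱ⟧ = cong (λ t → 𝜆 P.⊗ 𝑏 P.⊕ 𝜇 P.⊗ t) (⟦evalZᴱ⟧ (∂a (DZ n)) 𝑎ᴱ 𝑏ᴱ vars)

  ⟦⟨atCᴱ⟩⟧ : ∀ n e → ⟦ e ⟨ atCᴱ n ⟩ ⟧ vars ≡ ⟦ e ⟧ vars [ atC n ]
  ⟦⟨atCᴱ⟩⟧ n e = begin
    ⟦ e ⟨ atCᴱ n ⟩ ⟧ vars                         ≡⟨ ⟦⟧-⟨⟩ rawRing (con ∘ ℤ→K) e (atCᴱ n) vars ⟩
    ⟦ e ⟧ (Vec.map (λ t → ⟦ t ⟧ vars) (atCᴱ n))   ≡⟨ cong (⟦ e ⟧) atCᴱ≡atC ⟩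
    ⟦ e ⟧ (Vec.map (_[ atC n ]) vars)             ≡⟨ ⟦⟧-[] e vars (atC n) ⟨
    ⟦ e ⟧ vars [ atC n ]                          ∎
    where
    open ≡.≡-Reasoning
    atCᴱ≡atC : Vec.map (λ t → ⟦ t ⟧ vars) (atCᴱ n) ≡ Vec.map (_[ atC n ]) vars
    atCᴱ≡atC = cong₂ (λ s t → s ∷ t ∷ 𝜆 ∷ 𝜇 ∷ [])
      (⟦evalZᴱ⟧ (c4Z n) 𝑎ᴱ 𝑏ᴱ vars) (⟦evalZᴱ⟧ (c6Z n) 𝑎ᴱ 𝑏ᴱ vars)

  InKc4c6-from-certificate : ∀ n F e → IsCertificate n F e → InKc4c6 n (evalZ F (X n) (Y n))
  InKc4c6-from-certificate n F e certified = ⟦ e ⟧ vars , (begin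
    evalZ F (X n) (Y n)              ≡⟨ ⟦evalZᴱ⟧-at-XY n F ⟨
    ⟦ evalZᴱ F (Xᴱ n) (Yᴱ n) ⟧ vars  ≈⟨ ≈-by-normalisation (evalZᴱ F (Xᴱ n) (Yᴱ n)) (e ⟨ atCᴱ n ⟩) certified vars ⟩
    ⟦ e ⟨ atCᴱ n ⟩ ⟧ vars            ≡⟨ ⟦⟨atCᴱ⟩⟧ n e ⟩
    ⟦ e ⟧ vars [ atC n ]             ∎)
    where open Relation.Binary.Reasoning.Setoid setoid

  QuotInKc4c6-from-certificate : ∀ n e → IsQuotientCertificate n e → QuotInKc4c6 n
  QuotInKc4c6-from-certificate n e certified = ⟦ e ⟧ vars , (begin
    D n (X n) (Y n)                                         ≡⟨ ⟦evalZᴱ⟧-at-XY n (DZ n) ⟨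
    ⟦ evalZᴱ (DZ n) (Xᴱ n) (Yᴱ n) ⟧ vars
      ≈⟨ ≈-by-normalisation (evalZᴱ (DZ n) (Xᴱ n) (Yᴱ n)) (evalZᴱ (DZ n) 𝑎ᴱ 𝑏ᴱ ⊗ e ⟨ atCᴱ n ⟩) certified vars ⟩
    ⟦ evalZᴱ (DZ n) 𝑎ᴱ 𝑏ᴱ ⟧ vars P.⊗ ⟦ e ⟨ atCᴱ n ⟩ ⟧ vars   ≡⟨ cong₂ P._⊗_ (⟦evalZᴱ⟧ (DZ n) 𝑎ᴱ 𝑏ᴱ vars) (⟦⟨atCᴱ⟩⟧ n e) ⟩
    D n 𝑎 𝑏 P.⊗ (⟦ e ⟧ vars [ atC n ])                       ∎)
    where open Relation.Binary.Reasoning.Setoid setoid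

lemma8p4 : ∀ {c ℓ} (K : CommutativeRing c ℓ) → IsField K →
           (n : Index) →
           ¬ (CommutativeRing._≈_ K (Poly.ℕ→K K (6 ℕ.* val n)) (CommutativeRing.0# K)) →
           Poly.QuotInKc4c6 K n
             × Poly.InKc4c6 K n (Poly.c4 K n (Poly.X K n) (Poly.Y K n))
             × Poly.InKc4c6 K n (Poly.c6 K n (Poly.X K n) (Poly.Y K n))
lemma8p4 K _ n _ =
  QuotInKc4c6-from-certificate n (certificate (D-quotient-certificate n)) (D-quotient-certified n) ,
  InKc4c6-from-certificate n (c4Z n) (certificate (c4-certificate n)) (c4-certified n) ,
  InKc4c6-from-certificate n (c6Z n) (certificate (c6-certificate n)) (c6-certified n)
  where open CertificateSoundness K
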